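{- Let $A\in\mathbb{Z}^{d\times n}$ have rank $d$, and let $B^{(0)}$ be the nonsingular $d\times d$ matrix chosen in step 1 of the Generalized Euclidean Algorithm (basic version) described in the context. Then, for every admissible choice of $c$ and $\ell$ during the run, the algorithm performs at most $\log_2|\det(B^{(0)})|$ exchange steps (executions of the "otherwise" branch of step 3).
   Context: For a real number $y$, $\lfloor y\rfloor$ is the floor and $\lceil y\rfloor:=\lfloor y+1/2\rfloor$ is the nearest integer. Generalized Euclidean Algorithm (basic version), input $A=(A_1,\dots,A_n)\in\mathbb{Z}^{d\times n}$: 1. Find $d$ linearly independent columns of $A$ and let $B=(B_1,\dots,B_d)$ be the matrix they form. 2. Let $C$ be the collection of the remaining columns. 3. While $C\neq\emptyset$: choose any $c\in C$ and compute the rational solution $x\in\mathbb{Q}^d$ of $Bx=c$. If $x\in\mathbb{Z}^d$, remove $c$ from $C$. Otherwise (exchange step) choose any index $\ell\le d$ with $x_\ell\notin\mathbb{Z}$, replace $C$ by $(C\setminus\{c\})\cup\{B_\ell\}$ (using the old $B_\ell$), and replace the column $B_\ell$ by $c-\bigl(B_\ell\lceil x_\ell\rfloor+\sum_{j\neq\ell}B_j\lfloor x_j\rfloor\bigr)$. 4. Return $B$. -}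

module Defs where

open import Data.Nat as ℕ using (ℕ; zero; suc)
open import Data.Integer as ℤ using (ℤ; +_)
open import Data.Rational as ℚ using (ℚ; ½)
open import Data.Fin using (Fin; zero; suc; toℕ; punchIn; _≟_)
open import Data.Fin.Properties using () renaming (_≟_ to _≟F_)
open import Data.List using (List; []; _∷_; map; filter; allFin)
open import Data.List.Relation.Binary.Permutation.Propositional using (_↭_)
open import Data.Product using (Σ; ∃; _×_; _,_)
open import Relation.Nullary using (¬_; yes; no; Dec)
open import Relation.Nullary.Decidable using (¬?)
open import Relation.Binary.PropositionalEquality using (_≡_)
open import Data.Fin.Properties using (any?)

-- A column vector in ℤ^d, and a d×d integer matrix given by its d columns
-- (M j i = entry in row i, column j).
Col : ℕ → Set
Col d = Fin d → ℤ

Mat : ℕ → Set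
Mat d = Fin d → Col d

∑ℤ : ∀ {n} → (Fin n → ℤ) → ℤ
∑ℤ {zero}  f = + 0
∑ℤ {suc n} f = f zero ℤ.+ ∑ℤ (λ i → f (suc i))

∑ℚ : ∀ {n} → (Fin n → ℚ) → ℚ
∑ℚ {zero}  f = ℚ.0ℚ
∑ℚ {suc n} f = f zero ℚ.+ ∑ℚ (λ i → f (suc i))

sgn : ℕ → ℤ
sgn zero    = + 1
sgn (suc k) = ℤ.- sgn k

det : ∀ {d} → Mat d → ℤ
det {zero}  M = + 1
det {suc d} M =
  ∑ℤ (λ j → sgn (toℕ j) ℤ.* M j zero ℤ.* det (λ j' i' → M (punchIn j j') (suc i')))

toℚ : ℤ → ℚ
toℚ z = z ℚ./ 1

IsInt : ℚ → Set
IsInt q = ∃ λ (z : ℤ) → q ≡ toℚ z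

nearest : ℚ → ℤ
nearest y = ℚ.floor (y ℚ.+ ½)

LinIndep : ∀ {d} → Mat d → Set
LinIndep {d} M =
  (x : Fin d → ℚ) → (∀ i → ∑ℚ (λ j → x j ℚ.* toℚ (M j i)) ≡ ℚ.0ℚ) → ∀ j → x j ≡ ℚ.0ℚ

Solves : ∀ {d} → Mat d → (Fin d → ℚ) → Col d → Set
Solves {d} B x c = ∀ i → ∑ℚ (λ j → x j ℚ.* toℚ (B j i)) ≡ toℚ (c i)

coeff : ∀ {d} → (Fin d → ℚ) → Fin d → Fin d → ℤ
coeff x ℓ j with j ≟F ℓ
... | yes _ = nearest (x j)
... | no  _ = ℚ.floor (x j)

newCol : ∀ {d} → Mat d → Col d → (Fin d → ℚ) → Fin d → Col d
newCol B c x ℓ i = c i ℤ.- ∑ℤ (λ j → B j i ℤ.* coeff x ℓ j)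

replaceCol : ∀ {d} → Mat d → Fin d → Col d → Mat d
replaceCol B ℓ v j with j ≟F ℓ
... | yes _ = v
... | no  _ = B j

-- algorithm state: the current matrix B and the collection C (a list used as a multiset)
State : ℕ → Set
State d = Mat d × List (Col d)

-- one iteration of the while loop of step 3; the ℕ index counts exchange steps (0 or 1)
data Step {d : ℕ} : State d → ℕ → State d → Set where
  integral : ∀ (B : Mat d) (C C' : List (Col d)) (c : Col d) (x : Fin d → ℚ) →
             C ↭ (c ∷ C') → Solves B x c → (∀ j → IsInt (x j)) →
             Step (B , C) 0 (B , C')
  exchange : ∀ (B : Mat d) (C C' : List (Col d)) (c : Col d) (x : Fin d → ℚ) (ℓ : Fin d) →
             C ↭ (c ∷ C') → Solves B x c → ¬ IsInt (x ℓ) →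
             Step (B , C) 1 (replaceCol B ℓ (newCol B c x ℓ) , (B ℓ ∷ C'))

data Run {d : ℕ} : State d → ℕ → State d → Set where
  done : ∀ S → Run S 0 S
  next : ∀ {S T U k m} → Step S k T → Run T m U → Run S (k ℕ.+ m) U

-- step 1/2: the chosen columns σ and the remaining columns of A (with multiplicity)
chosen : ∀ {d n} → (Fin n → Col d) → (Fin d → Fin n) → Mat d
chosen A σ j = A (σ j)

remaining : ∀ {d n} → (Fin n → Col d) → (Fin d → Fin n) → List (Col d)
remaining {d} {n} A σ = map A (filter (λ i → ¬? (any? (λ j → σ j ≟F i))) (allFin n))

-- Each exchange step replaces column ℓ of B by c − Σⱼ κⱼ Bⱼ, where κ rounds x (to the nearest
-- integer at ℓ, down elsewhere). Since c = Σⱼ xⱼ Bⱼ, the new column is Σⱼ (xⱼ − κⱼ) Bⱼ, so by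
-- multilinearity and alternation the determinant gets multiplied by x_ℓ − ⌈x_ℓ⌋. As x_ℓ ∉ ℤ this
-- factor is nonzero and at most ½ in absolute value: every exchange keeps det B a nonzero integer
-- and at least halves |det B|. The initial determinant is nonzero because the chosen columns are
-- linearly independent, so after k exchanges 1 ≤ |det B| ≤ |det B⁽⁰⁾| / 2^k.

module Submission where

open import Defs
open import Data.Nat using (ℕ; _≤_; _^_)
open import Data.Integer using (∣_∣)
open import Data.Fin using (Fin)
open import Data.Product using (_,_)
open import Function.Definitions using (Injective)
open import Relation.Binary.PropositionalEquality using (_≡_)

open import Algebra.Bundles using (CommutativeRing)
open import Data.Empty using (⊥-elim)
open import Data.Fin using (zero; suc; toℕ; punchIn; punchOut; inject₁)
open import Data.Fin.Properties
  using (any?; _≟_; punchInᵢ≢i; punchIn-punchOut; punchIn-injective; toℕ-inject₁; toℕ-injective)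
open import Data.Integer as ℤ using (ℤ; +_; -[1+_])
import Data.Integer.DivMod as ℤ
import Data.Integer.Properties as ℤ
open import Data.Nat using (suc)
import Data.Nat as ℕ
import Data.Nat.Coprimality as Coprime
import Data.Nat.Properties as ℕ
open import Data.Product using (∃; _×_; proj₁; proj₂)
open import Data.Rational as ℚ using (ℚ; mkℚ; 0ℚ; 1ℚ; ½; _+_; _-_; _*_; -_)
import Data.Rational.Properties as ℚ
open import Data.Sum using (_⊎_; inj₁; inj₂)
open import Data.Vec.Functional using (removeAt; updateAt; insertAt)
open import Data.Vec.Functional.Properties
  using (updateAt-updates; updateAt-minimal; insertAt-lookup; insertAt-punchIn)
open import Function using (const)
open import Level using (0ℓ)
open import Relation.Binary.Definitions using (tri<; tri≈; tri>)
open import Relation.Binary.PropositionalEquality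
  using (_≢_; refl; sym; trans; cong; cong₂; subst; subst₂; module ≡-Reasoning)
open import Relation.Nullary using (¬_; yes; no)
open import Relation.Nullary.Decidable using (dec⇒maybe; ¬?; decidable-stable)
open import Tactic.RingSolver using (solve-∀)
open import Tactic.RingSolver.Core.AlmostCommutativeRing using (AlmostCommutativeRing; fromCommutativeRing)

open import Algebra.Properties.Group ℚ.+-0-group using (⁻¹-involutive; inverseʳ-unique)
open import Algebra.Properties.Semiring.Sum (CommutativeRing.semiring ℚ.+-*-commutativeRing)
  using (sum; sum-syntax; sum-cong-≗; sum-remove; sum-replicate-zero; ∑-distrib-+; *-distribˡ-sum)

-- Without a zero test the solver cannot simplify constant coefficients such as 0ℚ.
ℚ-ring : AlmostCommutativeRing 0ℓ 0ℓ
ℚ-ring = fromCommutativeRing ℚ.+-*-commutativeRing (λ q → dec⇒maybe (0ℚ ℚ.≟ q))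

-- Integers inside ℚ

toℚ-mkℚ : ∀ z → toℚ z ≡ mkℚ z 0 (Coprime.sym (Coprime.1-coprimeTo ∣ z ∣))
toℚ-mkℚ z = ℚ.↥p/↧p≡p (mkℚ z 0 _)

toℚ-injective : ∀ {a b} → toℚ a ≡ toℚ b → a ≡ b
toℚ-injective {a} {b} e = begin
  a                ≡⟨ cong ℚ.↥_ (sym (toℚ-mkℚ a)) ⟩
  ℚ.↥ (toℚ a)      ≡⟨ cong ℚ.↥_ e ⟩
  ℚ.↥ (toℚ b)      ≡⟨ cong ℚ.↥_ (toℚ-mkℚ b) ⟩
  b                ∎
  where open ≡-Reasoning

toℚ-+ : ∀ a b → toℚ (a ℤ.+ b) ≡ toℚ a + toℚ b
toℚ-+ a b = begin
  (a ℤ.+ b) ℚ./ 1                          ≡⟨ ℚ./-cong (sym (cong₂ ℤ._+_ (ℤ.*-identityʳ a) (ℤ.*-identityʳ b))) refl ⟩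
  (a ℤ.* + 1 ℤ.+ b ℤ.* + 1) ℚ./ 1          ≡⟨ cong₂ _+_ (toℚ-mkℚ a) (toℚ-mkℚ b) ⟨
  toℚ a + toℚ b                            ∎
  where open ≡-Reasoning

toℚ-* : ∀ a b → toℚ (a ℤ.* b) ≡ toℚ a * toℚ b
toℚ-* a b = sym (cong₂ _*_ (toℚ-mkℚ a) (toℚ-mkℚ b))

toℚ-neg : ∀ a → toℚ (ℤ.- a) ≡ - toℚ a
toℚ-neg (+ 0)      = refl
toℚ-neg (+ suc n)  = refl
toℚ-neg -[1+ n ]   = sym (⁻¹-involutive (toℚ (+ suc n)))

toℚ-∑ : ∀ {n} (f : Fin n → ℤ) → toℚ (∑ℤ f) ≡ sum (λ i → toℚ (f i))
toℚ-∑ {ℕ.zero} f = refl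
toℚ-∑ {suc n} f = trans (toℚ-+ (f zero) _) (cong (toℚ (f zero) ℚ.+_) (toℚ-∑ (λ i → f (suc i))))

∑ℚ≡sum : ∀ {n} (f : Fin n → ℚ) → ∑ℚ f ≡ sum f
∑ℚ≡sum {ℕ.zero} f = refl
∑ℚ≡sum {suc n} f = cong (f zero ℚ.+_) (∑ℚ≡sum (λ i → f (suc i)))

toℚ-∣∣ : ∀ z → ℚ.∣ toℚ z ∣ ≡ toℚ (+ ∣ z ∣)
toℚ-∣∣ (+ n)    = ℚ.0≤p⇒∣p∣≡p (subst (0ℚ ℚ.≤_) (sym (toℚ-mkℚ (+ n))) (ℚ.*≤* (subst (+ 0 ℤ.≤_) (sym (ℤ.*-identityʳ (+ n))) (ℤ.+≤+ ℕ.z≤n))))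
toℚ-∣∣ -[1+ n ] = trans (ℚ.∣-p∣≡∣p∣ (toℚ (+ suc n))) (toℚ-∣∣ (+ suc n))

toℚ-cancel-≤ : ∀ {a b} → toℚ a ℚ.≤ toℚ b → a ℤ.≤ b
toℚ-cancel-≤ {a} {b} a≤b = subst₂ ℤ._≤_ (ℤ.*-identityʳ a) (ℤ.*-identityʳ b)
  (ℚ.drop-*≤* (subst₂ ℚ._≤_ (toℚ-mkℚ a) (toℚ-mkℚ b) a≤b))

p*q≡0⇒q≡0 : ∀ {p q} → p ≢ 0ℚ → p * q ≡ 0ℚ → q ≡ 0ℚ
p*q≡0⇒q≡0 {p} {q} p≢0 pq≡0 = begin
  q                 ≡⟨ ℚ.*-identityˡ q ⟨
  1ℚ * q            ≡⟨ cong (ℚ._* q) (ℚ.*-inverseˡ p) ⟨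
  (p⁻¹ * p) * q     ≡⟨ ℚ.*-assoc p⁻¹ p q ⟩
  p⁻¹ * (p * q)     ≡⟨ cong (p⁻¹ ℚ.*_) pq≡0 ⟩
  p⁻¹ * 0ℚ          ≡⟨ ℚ.*-zeroʳ p⁻¹ ⟩
  0ℚ                ∎
  where
  open ≡-Reasoning
  instance _ = ℚ.≢-nonZero p≢0
  p⁻¹ = ℚ.1/ p

*-≢0 : ∀ {p q} → p ≢ 0ℚ → q ≢ 0ℚ → p * q ≢ 0ℚ
*-≢0 p≢0 q≢0 pq≡0 = q≢0 (p*q≡0⇒q≡0 p≢0 pq≡0)

-- Nearest integers

toℚ⌊p⌋≤p : ∀ p → toℚ (ℚ.floor p) ℚ.≤ p
toℚ⌊p⌋≤p p@(mkℚ n d-1 _) = subst (ℚ._≤ p) (sym (toℚ-mkℚ f))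
  (ℚ.*≤* (subst (f ℤ.* + suc d-1 ℤ.≤_) (sym (ℤ.*-identityʳ n)) (ℤ.[n/d]*d≤n n (+ suc d-1))))
  where f = ℚ.floor p

p<toℚ⌊p⌋+1 : ∀ p → p ℚ.< toℚ (ℚ.floor p) + 1ℚ
p<toℚ⌊p⌋+1 p@(mkℚ n d-1 _) = subst (p ℚ.<_) f+1≡ (ℚ.*<* n<)
  where
  d = suc d-1
  f = ℚ.floor p
  f+1≡ : mkℚ (f ℤ.+ + 1) 0 (Coprime.sym (Coprime.1-coprimeTo _)) ≡ toℚ f + 1ℚ
  f+1≡ = trans (sym (toℚ-mkℚ (f ℤ.+ + 1))) (toℚ-+ f (+ 1))
  n< : n ℤ.* + 1 ℤ.< (f ℤ.+ + 1) ℤ.* + d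
  n< = subst₂ ℤ._<_ (sym (ℤ.*-identityʳ n))
         (cong (ℤ._* + d) (trans (ℤ.+-comm (+ 1) (n ℤ./ℕ d)) (cong (ℤ._+ + 1) (sym (ℤ.div-pos-is-/ℕ n d)))))
         (ℤ.n<s[n/ℕd]*d n d)

-r≤p≤r⇒∣p∣≤r : ∀ {p r} → - r ℚ.≤ p → p ℚ.≤ r → ℚ.∣ p ∣ ℚ.≤ r
-r≤p≤r⇒∣p∣≤r {p} {r} -r≤p p≤r with ℚ.∣p∣≡p∨∣p∣≡-p p
... | inj₁ ∣p∣≡p  = subst (ℚ._≤ r) (sym ∣p∣≡p) p≤r
... | inj₂ ∣p∣≡-p = subst₂ ℚ._≤_ (sym ∣p∣≡-p) (⁻¹-involutive r) (ℚ.neg-antimono-≤ -r≤p)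

∣p-⌈p⌋∣≤½ : ∀ p → ℚ.∣ p - toℚ (nearest p) ∣ ℚ.≤ ½
∣p-⌈p⌋∣≤½ p = -r≤p≤r⇒∣p∣≤r lower (ℚ.<⇒≤ upper)
  where
  open ℚ.≤-Reasoning
  n = toℚ (nearest p)
  shift : ∀ a b → a - b ≡ (a + ½) - (b + ½)
  shift = solve-∀ ℚ-ring
  -½≡ : ∀ a → - ½ ≡ a - (a + ½)
  -½≡ = solve-∀ ℚ-ring
  ½≡ : ∀ a → (a + 1ℚ) - (a + ½) ≡ ½
  ½≡ = solve-∀ ℚ-ring
  lower : - ½ ℚ.≤ p - n
  lower = begin
    - ½                   ≡⟨ -½≡ n ⟩
    n - (n + ½)           ≤⟨ ℚ.+-monoˡ-≤ (- (n + ½)) (toℚ⌊p⌋≤p (p + ½)) ⟩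
    (p + ½) - (n + ½)     ≡⟨ shift p n ⟨
    p - n                 ∎
  upper : p - n ℚ.< ½
  upper = begin-strict
    p - n                 ≡⟨ shift p n ⟩
    (p + ½) - (n + ½)     <⟨ ℚ.+-monoˡ-< (- (n + ½)) (p<toℚ⌊p⌋+1 (p + ½)) ⟩
    (n + 1ℚ) - (n + ½)    ≡⟨ ½≡ n ⟩
    ½                     ∎

p-⌈p⌋≢0 : ∀ p → ¬ IsInt p → p - toℚ (nearest p) ≢ 0ℚ
p-⌈p⌋≢0 p ¬int err≡0 = ¬int (nearest p , (begin
  p                 ≡⟨ split p n ⟩
  (p - n) + n       ≡⟨ cong (ℚ._+ n) err≡0 ⟩
  0ℚ + n            ≡⟨ ℚ.+-identityˡ n ⟩
  n                 ∎))
  where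
  open ≡-Reasoning
  n = toℚ (nearest p)
  split : ∀ a b → a ≡ (a - b) + b
  split = solve-∀ ℚ-ring

-- Finite sums and linear systems

sum-zero : ∀ {n} {f : Fin n → ℚ} → (∀ i → f i ≡ 0ℚ) → sum f ≡ 0ℚ
sum-zero {n} f≡0 = trans (sum-cong-≗ f≡0) (sum-replicate-zero n)

sum-single : ∀ {n} (f : Fin (suc n) → ℚ) ℓ → (∀ k → f (punchIn ℓ k) ≡ 0ℚ) → sum f ≡ f ℓ
sum-single f ℓ rest≡0 = begin
  sum f                               ≡⟨ sum-remove f ⟩
  f ℓ + sum (removeAt f ℓ)            ≡⟨ cong (f ℓ ℚ.+_) (sum-zero rest≡0) ⟩
  f ℓ + 0ℚ                            ≡⟨ ℚ.+-identityʳ (f ℓ) ⟩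
  f ℓ                                 ∎
  where open ≡-Reasoning

sum-pair : ∀ {n} (f : Fin (suc n) → ℚ) {r q} → r ≢ q → (∀ j → j ≢ r → j ≢ q → f j ≡ 0ℚ) → sum f ≡ f r + f q
sum-pair {ℕ.zero} f {zero} {zero} r≢q _ = ⊥-elim (r≢q refl)
sum-pair {suc n} f {r} {q} r≢q rest≡0 = begin
  sum f                               ≡⟨ sum-remove f ⟩
  f r + sum (removeAt f r)            ≡⟨ cong (f r ℚ.+_) (sum-single (removeAt f r) q' others≡0) ⟩
  f r + f (punchIn r q')              ≡⟨ cong (λ j → f r + f j) (punchIn-punchOut r≢q) ⟩
  f r + f q                           ∎
  where
  open ≡-Reasoning
  q' = punchOut r≢q
  others≡0 : ∀ k → f (punchIn r (punchIn q' k)) ≡ 0ℚ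
  others≡0 k = rest≡0 _ (punchInᵢ≢i r _) λ e →
    punchInᵢ≢i q' k (punchIn-injective r _ _ (trans e (sym (punchIn-punchOut r≢q))))

sum-linear : ∀ {n} a b (f g : Fin n → ℚ) → ∑[ j < n ] (a * f j + b * g j) ≡ a * sum f + b * sum g
sum-linear a b f g = trans (∑-distrib-+ (λ j → a * f j) (λ j → b * g j))
  (cong₂ _+_ (sym (*-distribˡ-sum a f)) (sym (*-distribˡ-sum b g)))

-- A is given by its n columns in ℚ^m, as in Mat, so A · x = Σⱼ xⱼ Aⱼ.
_·_ : ∀ {m n} → (Fin n → Fin m → ℚ) → (Fin n → ℚ) → Fin m → ℚ
(A · x) i = sum (λ j → x j * A j i)

·-linear : ∀ {m n} (A : Fin n → Fin m → ℚ) a b x y i →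
           (A · (λ j → a * x j + b * y j)) i ≡ a * (A · x) i + b * (A · y) i
·-linear A a b x y i = trans (sum-cong-≗ λ j → distrib a b (x j) (y j) (A j i))
                              (sum-linear a b (λ j → x j * A j i) (λ j → y j * A j i))
  where
  distrib : ∀ a b x y c → (a * x + b * y) * c ≡ a * (x * c) + b * (y * c)
  distrib = solve-∀ ℚ-ring

·-insertAt : ∀ {m n} (A : Fin (suc n) → Fin m → ℚ) z j t i →
             (A · insertAt z j t) i ≡ t * A j i + (removeAt A j · z) i
·-insertAt A z j t i = trans (sum-remove (λ k → insertAt z j t k * A k i))
  (cong₂ _+_ (cong (ℚ._* A j i) (insertAt-lookup z j t))
             (sum-cong-≗ λ k → cong (ℚ._* A (punchIn j k) i) (insertAt-punchIn z j t k)))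

LinearlyIndependent : ∀ {m n} → (Fin n → Fin m → ℚ) → Set
LinearlyIndependent A = ∀ x → (∀ i → (A · x) i ≡ 0ℚ) → ∀ j → x j ≡ 0ℚ

-- Subtracting multiples of the pivot column j₀ clears the first row; a solution z of the remaining
-- rows then extends to a solution of A by choosing its j₀-th coordinate to satisfy the first row.
pivot-elimination : ∀ {m n} (A : Fin (suc n) → Fin (suc m) → ℚ) j₀ → A j₀ zero ≢ 0ℚ →
  ∃ λ (A' : Fin n → Fin m → ℚ) → ∀ z → (∀ i → (A' · z) i ≡ 0ℚ) → ∃ λ t → ∀ i → (A · insertAt z j₀ t) i ≡ 0ℚ
pivot-elimination {m} {n} A j₀ pivot≢0 = A' , λ z A'z≡0 → t z , solves z A'z≡0
  where
  instance _ = ℚ.≢-nonZero pivot≢0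
  r = ℚ.1/ (A j₀ zero)
  Ã : Fin n → Fin (suc m) → ℚ
  Ã = removeAt A j₀
  A' : Fin n → Fin m → ℚ
  A' k i = Ã k (suc i) - (Ã k zero * r) * A j₀ (suc i)
  t : (Fin n → ℚ) → ℚ
  t z = - ((Ã · z) zero * r)
  cancel : ∀ S r p → - (S * r) * p + S ≡ - S * (r * p) + S
  cancel = solve-∀ ℚ-ring
  eliminate : ∀ z u v r a → z * (u - (v * r) * a) ≡ 1ℚ * (z * u) + (- (r * a)) * (z * v)
  eliminate = solve-∀ ℚ-ring
  regroup : ∀ S r a T → - (S * r) * a + T ≡ 1ℚ * T + (- (r * a)) * S
  regroup = solve-∀ ℚ-ring
  solves : ∀ z → (∀ i → (A' · z) i ≡ 0ℚ) → ∀ i → (A · insertAt z j₀ (t z)) i ≡ 0ℚ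
  solves z _ zero = begin
    (A · insertAt z j₀ (t z)) zero      ≡⟨ ·-insertAt A z j₀ (t z) zero ⟩
    t z * A j₀ zero + S                 ≡⟨ cancel S r (A j₀ zero) ⟩
    - S * (r * A j₀ zero) + S           ≡⟨ cong (λ u → - S * u + S) (ℚ.*-inverseˡ (A j₀ zero)) ⟩
    - S * 1ℚ + S                        ≡⟨ cong (ℚ._+ S) (ℚ.*-identityʳ (- S)) ⟩
    - S + S                             ≡⟨ ℚ.+-inverseˡ S ⟩
    0ℚ                                  ∎
    where
    open ≡-Reasoning
    S = (Ã · z) zero
  solves z A'z≡0 (suc i) = begin
    (A · insertAt z j₀ (t z)) (suc i)                     ≡⟨ ·-insertAt A z j₀ (t z) (suc i) ⟩
    t z * a + (Ã · z) (suc i)                             ≡⟨ regroup S r a _ ⟩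
    1ℚ * (Ã · z) (suc i) + (- (r * a)) * S                ≡⟨ sum-linear 1ℚ (- (r * a)) (λ k → z k * Ã k (suc i)) (λ k → z k * Ã k zero) ⟨
    ∑[ k < n ] (1ℚ * (z k * Ã k (suc i)) + (- (r * a)) * (z k * Ã k zero))
                                                          ≡⟨ sum-cong-≗ (λ k → eliminate (z k) _ _ r a) ⟨
    (A' · z) i                                            ≡⟨ A'z≡0 i ⟩
    0ℚ                                                    ∎
    where
    open ≡-Reasoning
    S = (Ã · z) zero
    a = A j₀ (suc i)

homogeneous-nontrivial : ∀ {m n} → m ℕ.< n → (A : Fin n → Fin m → ℚ) →
                         ∃ λ x → (∃ λ j → x j ≢ 0ℚ) × (∀ i → (A · x) i ≡ 0ℚ)
homogeneous-nontrivial {ℕ.zero} {suc n} _ A = (λ _ → 1ℚ) , (zero , ℚ.1≢0) , λ ()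
homogeneous-nontrivial {suc m} {suc n} (ℕ.s≤s m<n) A with any? (λ j → ¬? (A j zero ℚ.≟ 0ℚ))
... | no no-pivot with homogeneous-nontrivial (ℕ.m<n⇒m<1+n m<n) (λ j i → A j (suc i))
...   | x , x≢0 , lower≡0 = x , x≢0 , solves
  where
  top≡0 : ∀ j → A j zero ≡ 0ℚ
  top≡0 j = decidable-stable (A j zero ℚ.≟ 0ℚ) (λ A≢0 → no-pivot (j , A≢0))
  solves : ∀ i → (A · x) i ≡ 0ℚ
  solves zero    = sum-zero λ j → trans (cong (x j ℚ.*_) (top≡0 j)) (ℚ.*-zeroʳ (x j))
  solves (suc i) = lower≡0 i
homogeneous-nontrivial {suc m} {suc n} (ℕ.s≤s m<n) A | yes (j₀ , pivot≢0)
  with pivot-elimination A j₀ pivot≢0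
... | A' , extend with homogeneous-nontrivial m<n A'
...   | z , (k , zk≢0) , A'z≡0 with extend z A'z≡0
...     | t , solves = insertAt z j₀ t , (punchIn j₀ k , subst (_≢ 0ℚ) (sym (insertAt-punchIn z j₀ t k)) zk≢0) , solves

-- Determinants over ℚ

Matℚ : ℕ → Set
Matℚ d = Fin d → Fin d → ℚ

toℚᴹ : ∀ {d} → Mat d → Matℚ d
toℚᴹ M j i = toℚ (M j i)

minor : ∀ {d} → Matℚ (suc d) → Fin (suc d) → Matℚ d
minor M j j' i' = M (punchIn j j') (suc i')

sgnℚ : ℕ → ℚ
sgnℚ k = toℚ (sgn k)

sgnℚ-≢0 : ∀ k → sgnℚ k ≢ 0ℚ
sgnℚ-≢0 k sgn≡0 = ℕ.1+n≢0 (trans (sym (∣sgn∣≡1 k)) (cong ∣_∣ (toℚ-injective {sgn k} {+ 0} sgn≡0)))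
  where
  ∣sgn∣≡1 : ∀ k → ∣ sgn k ∣ ≡ 1
  ∣sgn∣≡1 ℕ.zero   = refl
  ∣sgn∣≡1 (suc k) = trans (ℤ.∣-i∣≡∣i∣ (sgn k)) (∣sgn∣≡1 k)

detℚ : ∀ {d} → Matℚ d → ℚ
detℚ {ℕ.zero} M = 1ℚ
detℚ {suc d} M = ∑[ j < suc d ] (sgnℚ (toℕ j) * M j zero * detℚ (minor M j))

toℚ-det : ∀ {d} (M : Mat d) → toℚ (det M) ≡ detℚ (toℚᴹ M)
toℚ-det {ℕ.zero} M = refl
toℚ-det {suc d} M = trans (toℚ-∑ term) (sum-cong-≗ λ j →
  trans (toℚ-* (sgn (toℕ j) ℤ.* M j zero) (det (minorℤ j)))
        (cong₂ _*_ (toℚ-* (sgn (toℕ j)) (M j zero)) (toℚ-det (minorℤ j))))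
  where
  minorℤ : Fin (suc d) → Mat d
  minorℤ j j' i' = M (punchIn j j') (suc i')
  term : Fin (suc d) → ℤ
  term j = sgn (toℕ j) ℤ.* M j zero ℤ.* det (minorℤ j)

detℚ-cong : ∀ {d} {M N : Matℚ d} → (∀ j i → M j i ≡ N j i) → detℚ M ≡ detℚ N
detℚ-cong {ℕ.zero} M≡N = refl
detℚ-cong {suc d} M≡N = sum-cong-≗ λ j →
  cong₂ (λ x m → sgnℚ (toℕ j) * x * m) (M≡N j zero) (detℚ-cong (λ j' i' → M≡N (punchIn j j') (suc i')))

AgreeOutside : ∀ {d} → Fin d → Matℚ d → Matℚ d → Set
AgreeOutside ℓ M N = ∀ j → j ≢ ℓ → ∀ i → M j i ≡ N j i

module _ {d} {M N : Matℚ (suc d)} {ℓ : Fin (suc d)} (M≈N : AgreeOutside ℓ M N) where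

  minor-agree-at : ∀ j' i' → minor M ℓ j' i' ≡ minor N ℓ j' i'
  minor-agree-at j' i' = M≈N (punchIn ℓ j') (punchInᵢ≢i ℓ j') (suc i')

  minor-agree-outside : ∀ {j} (j≢ℓ : j ≢ ℓ) → AgreeOutside (punchOut j≢ℓ) (minor M j) (minor N j)
  minor-agree-outside {j} j≢ℓ j' j'≢ℓ' i' = M≈N (punchIn j j') punchIn≢ℓ (suc i')
    where
    punchIn≢ℓ : punchIn j j' ≢ ℓ
    punchIn≢ℓ e = j'≢ℓ' (punchIn-injective j j' _ (trans e (sym (punchIn-punchOut j≢ℓ))))

minor-punchOut : ∀ {d} (M : Matℚ (suc d)) {j ℓ} (j≢ℓ : j ≢ ℓ) i' → minor M j (punchOut j≢ℓ) i' ≡ M ℓ (suc i')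
minor-punchOut M j≢ℓ i' = cong (λ c → M c (suc i')) (punchIn-punchOut j≢ℓ)

detℚ-linear : ∀ {d} {X Y Z : Matℚ d} ℓ a b → AgreeOutside ℓ Z X → AgreeOutside ℓ Z Y →
              (∀ i → Z ℓ i ≡ a * X ℓ i + b * Y ℓ i) → detℚ Z ≡ a * detℚ X + b * detℚ Y
detℚ-linear {suc d} {X} {Y} {Z} ℓ a b Z≈X Z≈Y Zℓ≡ =
  trans (sum-cong-≗ term) (sum-linear a b (T X) (T Y))
  where
  open ≡-Reasoning
  T : Matℚ (suc d) → Fin (suc d) → ℚ
  T M j = sgnℚ (toℕ j) * M j zero * detℚ (minor M j)
  distrib-mid : ∀ a b s x y m → s * (a * x + b * y) * m ≡ a * (s * x * m) + b * (s * y * m)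
  distrib-mid = solve-∀ ℚ-ring
  distrib-end : ∀ a b s x m n → s * x * (a * m + b * n) ≡ a * (s * x * m) + b * (s * x * n)
  distrib-end = solve-∀ ℚ-ring
  term : ∀ j → T Z j ≡ a * T X j + b * T Y j
  term j with j ≟ ℓ
  ... | yes refl = begin
    s * Z ℓ zero * detℚ (minor Z ℓ)                        ≡⟨ cong (λ z → s * z * detℚ (minor Z ℓ)) (Zℓ≡ zero) ⟩
    s * (a * X ℓ zero + b * Y ℓ zero) * detℚ (minor Z ℓ)   ≡⟨ distrib-mid a b s _ _ _ ⟩
    a * (s * X ℓ zero * detℚ (minor Z ℓ)) + b * (s * Y ℓ zero * detℚ (minor Z ℓ))
      ≡⟨ cong₂ (λ m n → a * (s * X ℓ zero * m) + b * (s * Y ℓ zero * n))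
               (detℚ-cong (minor-agree-at Z≈X)) (detℚ-cong (minor-agree-at Z≈Y)) ⟩
    a * T X ℓ + b * T Y ℓ                                   ∎
    where s = sgnℚ (toℕ ℓ)
  ... | no j≢ℓ = begin
    s * Z j zero * detℚ (minor Z j)                         ≡⟨ cong (λ m → s * Z j zero * m) minor-linear ⟩
    s * Z j zero * (a * detℚ (minor X j) + b * detℚ (minor Y j))
      ≡⟨ distrib-end a b s _ _ _ ⟩
    a * (s * Z j zero * detℚ (minor X j)) + b * (s * Z j zero * detℚ (minor Y j))
      ≡⟨ cong₂ (λ x y → a * (s * x * detℚ (minor X j)) + b * (s * y * detℚ (minor Y j)))
               (Z≈X j j≢ℓ zero) (Z≈Y j j≢ℓ zero) ⟩
    a * T X j + b * T Y j                                   ∎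
    where
    s = sgnℚ (toℕ j)
    minor-linear : detℚ (minor Z j) ≡ a * detℚ (minor X j) + b * detℚ (minor Y j)
    minor-linear = detℚ-linear (punchOut j≢ℓ) a b (minor-agree-outside Z≈X j≢ℓ) (minor-agree-outside Z≈Y j≢ℓ)
      λ i' → trans (minor-punchOut Z j≢ℓ i') (trans (Zℓ≡ (suc i'))
               (sym (cong₂ (λ x y → a * x + b * y) (minor-punchOut X j≢ℓ i') (minor-punchOut Y j≢ℓ i'))))

detℚ-additive : ∀ {d} {X Y Z : Matℚ d} ℓ → AgreeOutside ℓ Z X → AgreeOutside ℓ Z Y →
                (∀ i → Z ℓ i ≡ X ℓ i + Y ℓ i) → detℚ Z ≡ detℚ X + detℚ Y
detℚ-additive {X = X} {Y} ℓ Z≈X Z≈Y Zℓ≡ =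
  trans (detℚ-linear ℓ 1ℚ 1ℚ Z≈X Z≈Y λ i → trans (Zℓ≡ i) (one-one (X ℓ i) (Y ℓ i))) (sym (one-one (detℚ X) (detℚ Y)))
  where
  one-one : ∀ x y → x + y ≡ 1ℚ * x + 1ℚ * y
  one-one = solve-∀ ℚ-ring

detℚ-zero-column : ∀ {d} (M : Matℚ d) ℓ → (∀ i → M ℓ i ≡ 0ℚ) → detℚ M ≡ 0ℚ
detℚ-zero-column M ℓ Mℓ≡0 =
  trans (detℚ-linear ℓ 0ℚ 0ℚ same same λ i → trans (Mℓ≡0 i) (zero-sum (M ℓ i))) (sym (zero-sum (detℚ M)))
  where
  same : AgreeOutside ℓ M M
  same _ _ _ = refl
  zero-sum : ∀ x → 0ℚ ≡ 0ℚ * x + 0ℚ * x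
  zero-sum = solve-∀ ℚ-ring

setColumn : ∀ {d} → Matℚ d → Fin d → (Fin d → ℚ) → Matℚ d
setColumn M ℓ v = updateAt M ℓ (const v)

setColumn-at : ∀ {d} (M : Matℚ d) ℓ v → setColumn M ℓ v ℓ ≡ v
setColumn-at M ℓ v = updateAt-updates ℓ M

setColumn-outside : ∀ {d} (M : Matℚ d) {ℓ} v → AgreeOutside ℓ (setColumn M ℓ v) M
setColumn-outside M {ℓ} v j j≢ℓ i = cong (λ c → c i) (updateAt-minimal j ℓ M j≢ℓ)

punchIn-adjacent : ∀ {n} (p : Fin n) j →
  punchIn (inject₁ p) j ≡ punchIn (suc p) j ⊎ (punchIn (inject₁ p) j ≡ suc p × punchIn (suc p) j ≡ inject₁ p)
punchIn-adjacent zero    zero    = inj₂ (refl , refl)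
punchIn-adjacent zero    (suc j) = inj₁ refl
punchIn-adjacent (suc p) zero    = inj₁ refl
punchIn-adjacent (suc p) (suc j) with punchIn-adjacent p j
... | inj₁ same          = inj₁ (cong suc same)
... | inj₂ (e₁ , e₂)     = inj₂ (cong suc e₁ , cong suc e₂)

punchIn-preimage-adjacent : ∀ {n} (p : Fin (suc n)) j → j ≢ inject₁ p → j ≢ suc p →
  ∃ λ (p' : Fin n) → punchIn j (inject₁ p') ≡ inject₁ p × punchIn j (suc p') ≡ suc p
punchIn-preimage-adjacent zero    zero          j≢p _   = ⊥-elim (j≢p refl)
punchIn-preimage-adjacent (suc p) zero          _   _   = p , refl , refl
punchIn-preimage-adjacent zero    (suc zero)    _   j≢q = ⊥-elim (j≢q refl)
punchIn-preimage-adjacent {suc n} zero    (suc (suc j)) _ _ = zero , refl , refl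
punchIn-preimage-adjacent {suc n} (suc p) (suc j) j≢p j≢q
  with punchIn-preimage-adjacent p j (λ e → j≢p (cong suc e)) (λ e → j≢q (cong suc e))
... | p' , e₁ , e₂ = suc p' , cong suc e₁ , cong suc e₂

-- In the first-row expansion the two terms of the equal columns cancel (equal minors, opposite
-- signs), and every other minor again has two equal adjacent columns.
detℚ-adjacent-equal : ∀ {n} (M : Matℚ (suc n)) (p : Fin n) → (∀ i → M (inject₁ p) i ≡ M (suc p) i) → detℚ M ≡ 0ℚ
detℚ-adjacent-equal {suc n} M p Mp≡Mq = begin
  detℚ M              ≡⟨ sum-pair T p≢q others≡0 ⟩
  T p⁻ + T (suc p)    ≡⟨ cong (T p⁻ ℚ.+_) Tq≡-Tp ⟩
  T p⁻ - T p⁻         ≡⟨ ℚ.+-inverseʳ (T p⁻) ⟩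
  0ℚ                  ∎
  where
  open ≡-Reasoning
  p⁻ = inject₁ p
  T : Fin (suc (suc n)) → ℚ
  T j = sgnℚ (toℕ j) * M j zero * detℚ (minor M j)
  p≢q : p⁻ ≢ suc p
  p≢q e = ℕ.1+n≢n (trans (sym (cong toℕ e)) (toℕ-inject₁ p))
  others≡0 : ∀ j → j ≢ p⁻ → j ≢ suc p → T j ≡ 0ℚ
  others≡0 j j≢p j≢q with punchIn-preimage-adjacent p j j≢p j≢q
  ... | p' , e₁ , e₂ = trans (cong (sgnℚ (toℕ j) * M j zero ℚ.*_)
         (detℚ-adjacent-equal (minor M j) p' λ i' → trans (cong (λ c → M c (suc i')) e₁)
           (trans (Mp≡Mq (suc i')) (cong (λ c → M c (suc i')) (sym e₂)))))
         (ℚ.*-zeroʳ (sgnℚ (toℕ j) * M j zero))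
  minors-equal : ∀ j' i' → minor M (suc p) j' i' ≡ minor M p⁻ j' i'
  minors-equal j' i' with punchIn-adjacent p j'
  ... | inj₁ same       = cong (λ c → M c (suc i')) (sym same)
  ... | inj₂ (e₁ , e₂)  = trans (cong (λ c → M c (suc i')) e₂)
                            (trans (Mp≡Mq (suc i')) (cong (λ c → M c (suc i')) (sym e₁)))
  Tq≡-Tp : T (suc p) ≡ - T p⁻
  Tq≡-Tp = begin
    sgnℚ (suc (toℕ p)) * M (suc p) zero * detℚ (minor M (suc p))
      ≡⟨ cong₂ (λ x m → sgnℚ (suc (toℕ p)) * x * m) (sym (Mp≡Mq zero)) (detℚ-cong minors-equal) ⟩
    sgnℚ (suc (toℕ p)) * M p⁻ zero * detℚ (minor M p⁻)
      ≡⟨ cong (λ k → sgnℚ (suc k) * M p⁻ zero * detℚ (minor M p⁻)) (sym (toℕ-inject₁ p)) ⟩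
    sgnℚ (suc (toℕ p⁻)) * M p⁻ zero * detℚ (minor M p⁻)
      ≡⟨ cong (λ s → s * M p⁻ zero * detℚ (minor M p⁻)) (toℚ-neg (sgn (toℕ p⁻))) ⟩
    - sgnℚ (toℕ p⁻) * M p⁻ zero * detℚ (minor M p⁻)
      ≡⟨ neg-out (sgnℚ (toℕ p⁻)) _ _ ⟩
    - T p⁻  ∎
    where
    neg-out : ∀ s x m → - s * x * m ≡ - (s * x * m)
    neg-out = solve-∀ ℚ-ring

setColumns : ∀ {d} → Matℚ d → Fin d → Fin d → (Fin d → ℚ) → (Fin d → ℚ) → Matℚ d
setColumns M r q x y = setColumn (setColumn M q y) r x

swapColumns : ∀ {d} → Matℚ d → Fin d → Fin d → Matℚ d
swapColumns M r q = setColumns M r q (M q) (M r)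

module _ {d} (M : Matℚ d) {r q : Fin d} where

  setColumns-at-r : ∀ x y i → setColumns M r q x y r i ≡ x i
  setColumns-at-r x y i = cong (λ c → c i) (setColumn-at _ r x)

  setColumns-at-q : q ≢ r → ∀ x y i → setColumns M r q x y q i ≡ y i
  setColumns-at-q q≢r x y i = trans (setColumn-outside _ x q q≢r i) (cong (λ c → c i) (setColumn-at M q y))

  setColumns-outside : ∀ x y j → j ≢ r → j ≢ q → ∀ i → setColumns M r q x y j i ≡ M j i
  setColumns-outside x y j j≢r j≢q i = trans (setColumn-outside _ x j j≢r i) (setColumn-outside M y j j≢q i)

  setColumns-same : q ≢ r → ∀ j i → setColumns M r q (M r) (M q) j i ≡ M j i
  setColumns-same q≢r j i with j ≟ r | j ≟ q
  ... | yes refl | _        = setColumns-at-r (M r) (M q) i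
  ... | no _     | yes refl = setColumns-at-q q≢r (M r) (M q) i
  ... | no j≢r   | no j≢q   = setColumns-outside (M r) (M q) j j≢r j≢q i

  setColumns-agree-r : ∀ x x' y → AgreeOutside r (setColumns M r q x y) (setColumns M r q x' y)
  setColumns-agree-r x x' y j j≢r i = trans (setColumn-outside _ x j j≢r i) (sym (setColumn-outside _ x' j j≢r i))

  setColumns-agree-q : ∀ x y y' → AgreeOutside q (setColumns M r q x y) (setColumns M r q x y')
  setColumns-agree-q x y y' j j≢q i with j ≟ r
  ... | yes refl = trans (setColumns-at-r x y i) (sym (setColumns-at-r x y' i))
  ... | no j≢r   = trans (setColumns-outside x y j j≢r j≢q i) (sym (setColumns-outside x y' j j≢r j≢q i))

-- Expand 0 = det S(u + v, u + v) bilinearly in the two columns.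
detℚ-swap-adjacent : ∀ {n} (M : Matℚ (suc n)) (p : Fin n) → detℚ (swapColumns M (inject₁ p) (suc p)) ≡ - detℚ M
detℚ-swap-adjacent {n} M p = inverseʳ-unique (detℚ M) (detℚ (S v u)) (begin
  detℚ M + detℚ (S v u)                          ≡⟨ cong₂ _+_ (sym (ℚ.+-identityˡ (detℚ M))) (sym (ℚ.+-identityʳ (detℚ (S v u)))) ⟩
  (0ℚ + detℚ M) + (detℚ (S v u) + 0ℚ)            ≡⟨ cong₂ (λ x y → (x + detℚ M) + (detℚ (S v u) + y)) (sym (equal u)) (sym (equal v)) ⟩
  (detℚ (S u u) + detℚ M) + (detℚ (S v u) + detℚ (S v v))
      ≡⟨ cong (λ x → (detℚ (S u u) + x) + (detℚ (S v u) + detℚ (S v v))) (sym (detℚ-cong (setColumns-same M {r} q≢r))) ⟩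
  (detℚ (S u u) + detℚ (S u v)) + (detℚ (S v u) + detℚ (S v v))
      ≡⟨ cong₂ _+_ (sym (split-q u)) (sym (split-q v)) ⟩
  detℚ (S u s) + detℚ (S v s)                    ≡⟨ sym (split-r s) ⟩
  detℚ (S s s)                                   ≡⟨ equal s ⟩
  0ℚ                                             ∎)
  where
  open ≡-Reasoning
  r = inject₁ p
  q = suc p
  u = M r
  v = M q
  s : Fin (suc n) → ℚ
  s i = u i + v i
  q≢r : q ≢ r
  q≢r e = ℕ.1+n≢n (trans (cong toℕ e) (toℕ-inject₁ p))
  S = setColumns M r q
  S-at-r = setColumns-at-r M {r} {q}
  S-at-q = setColumns-at-q M {r} {q} q≢r
  equal : ∀ x → detℚ (S x x) ≡ 0ℚ
  equal x = detℚ-adjacent-equal (S x x) p λ i → trans (S-at-r x x i) (sym (S-at-q x x i))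
  split-q : ∀ x → detℚ (S x s) ≡ detℚ (S x u) + detℚ (S x v)
  split-q x = detℚ-additive q (setColumns-agree-q M {r} x s u) (setColumns-agree-q M {r} x s v)
    λ i → trans (S-at-q x s i) (sym (cong₂ _+_ (S-at-q x u i) (S-at-q x v i)))
  split-r : ∀ y → detℚ (S s y) ≡ detℚ (S u y) + detℚ (S v y)
  split-r y = detℚ-additive r (setColumns-agree-r M {q = q} s u y) (setColumns-agree-r M {q = q} s v y)
    λ i → trans (S-at-r s y i) (sym (cong₂ _+_ (S-at-r u y i) (S-at-r v y i)))

-- Move column q next to column p by adjacent swaps.
detℚ-equal-columns-apart : ∀ k {d} (M : Matℚ d) p q → suc (toℕ p ℕ.+ k) ≡ toℕ q →
                           (∀ i → M p i ≡ M q i) → detℚ M ≡ 0ℚ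
detℚ-equal-columns-apart ℕ.zero M p (suc q) p+1≡q Mp≡Mq =
  detℚ-adjacent-equal M q λ i → trans (cong (λ c → M c i) (sym p≡q⁻)) (Mp≡Mq i)
  where
  p≡q⁻ : p ≡ inject₁ q
  p≡q⁻ = toℕ-injective (trans (sym (ℕ.+-identityʳ (toℕ p))) (trans (ℕ.suc-injective p+1≡q) (sym (toℕ-inject₁ q))))
detℚ-equal-columns-apart (suc k) M p (suc q) p+k+2≡q Mp≡Mq = begin
  detℚ M              ≡⟨ ⁻¹-involutive (detℚ M) ⟨
  - - detℚ M          ≡⟨ cong -_ (detℚ-swap-adjacent M q) ⟨
  - detℚ M'           ≡⟨ cong -_ M'-singular ⟩
  - 0ℚ                ≡⟨⟩
  0ℚ                  ∎
  where
  open ≡-Reasoning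
  M' = swapColumns M (inject₁ q) (suc q)
  p+k+1≡q⁻ : suc (toℕ p ℕ.+ k) ≡ toℕ (inject₁ q)
  p+k+1≡q⁻ = trans (sym (ℕ.+-suc (toℕ p) k)) (trans (ℕ.suc-injective p+k+2≡q) (sym (toℕ-inject₁ q)))
  p≢q⁻ : p ≢ inject₁ q
  p≢q⁻ e = ℕ.m≢1+m+n (toℕ p) (trans (cong toℕ e) (sym p+k+1≡q⁻))
  p≢q : p ≢ suc q
  p≢q e = ℕ.m≢1+m+n (toℕ p) (trans (cong toℕ e) (sym p+k+2≡q))
  M'-singular : detℚ M' ≡ 0ℚ
  M'-singular = detℚ-equal-columns-apart k M' p (inject₁ q) p+k+1≡q⁻ λ i → begin
    M' p i                                  ≡⟨ setColumn-outside _ (M (suc q)) p p≢q⁻ i ⟩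
    setColumn M (suc q) (M (inject₁ q)) p i ≡⟨ setColumn-outside M (M (inject₁ q)) p p≢q i ⟩
    M p i                                   ≡⟨ Mp≡Mq i ⟩
    M (suc q) i                             ≡⟨ cong (λ c → c i) (setColumn-at _ (inject₁ q) (M (suc q))) ⟨
    M' (inject₁ q) i                        ∎

detℚ-equal-columns : ∀ {d} (M : Matℚ d) {p q} → p ≢ q → (∀ i → M p i ≡ M q i) → detℚ M ≡ 0ℚ
detℚ-equal-columns M {p} {q} p≢q Mp≡Mq with ℕ.<-cmp (toℕ p) (toℕ q)
... | tri< p<q _ _ = detℚ-equal-columns-apart _ M p q (proj₂ (ℕ.m≤n⇒∃[o]m+o≡n p<q)) Mp≡Mq
... | tri≈ _ p≡q _ = ⊥-elim (p≢q (toℕ-injective p≡q))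
... | tri> _ _ q<p = detℚ-equal-columns-apart _ M q p (proj₂ (ℕ.m≤n⇒∃[o]m+o≡n q<p)) (λ i → sym (Mp≡Mq i))

detℚ-add-combination : ∀ {d} {B Z : Matℚ d} ℓ c {n} (w : Fin n → ℚ) (g : Fin n → Fin d) → (∀ k → g k ≢ ℓ) →
  AgreeOutside ℓ Z B → (∀ i → Z ℓ i ≡ c * B ℓ i + ∑[ k < n ] (w k * B (g k) i)) → detℚ Z ≡ c * detℚ B
detℚ-add-combination {B = B} ℓ c {ℕ.zero} w g g≢ℓ Z≈B Zℓ≡ =
  trans (detℚ-linear ℓ c 0ℚ Z≈B Z≈B λ i → trans (Zℓ≡ i) (plus-0* c (B ℓ i))) (sym (zero* c (detℚ B)))
  where
  plus-0* : ∀ c x → c * x + 0ℚ ≡ c * x + 0ℚ * x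
  plus-0* = solve-∀ ℚ-ring
  zero* : ∀ c x → c * x ≡ c * x + 0ℚ * x
  zero* = solve-∀ ℚ-ring
detℚ-add-combination {B = B} {Z} ℓ c {suc n} w g g≢ℓ Z≈B Zℓ≡ = begin
  detℚ Z                          ≡⟨ detℚ-linear ℓ (w zero) 1ℚ Z≈X Z≈Y Zℓ-split ⟩
  w zero * detℚ X + 1ℚ * detℚ Y   ≡⟨ cong₂ (λ x y → w zero * x + 1ℚ * y) X-singular Y-det ⟩
  w zero * 0ℚ + 1ℚ * (c * detℚ B) ≡⟨ drop-0 (w zero) (c * detℚ B) ⟩
  c * detℚ B                      ∎
  where
  open ≡-Reasoning
  rest : Fin _ → ℚ
  rest i = ∑[ k < n ] (w (suc k) * B (g (suc k)) i)
  X = setColumn B ℓ (B (g zero))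
  Y = setColumn B ℓ (λ i → c * B ℓ i + rest i)
  Z≈X : AgreeOutside ℓ Z X
  Z≈X j j≢ℓ i = trans (Z≈B j j≢ℓ i) (sym (setColumn-outside B _ j j≢ℓ i))
  Z≈Y : AgreeOutside ℓ Z Y
  Z≈Y j j≢ℓ i = trans (Z≈B j j≢ℓ i) (sym (setColumn-outside B _ j j≢ℓ i))
  regroup : ∀ c x w y r → c * x + (w * y + r) ≡ w * y + 1ℚ * (c * x + r)
  regroup = solve-∀ ℚ-ring
  drop-0 : ∀ w x → w * 0ℚ + 1ℚ * x ≡ x
  drop-0 = solve-∀ ℚ-ring
  Zℓ-split : ∀ i → Z ℓ i ≡ w zero * X ℓ i + 1ℚ * Y ℓ i
  Zℓ-split i = trans (Zℓ≡ i) (trans (regroup c (B ℓ i) (w zero) (B (g zero) i) (rest i))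
    (sym (cong₂ (λ x y → w zero * x + 1ℚ * y) (cong (λ v → v i) (setColumn-at B ℓ _)) (cong (λ v → v i) (setColumn-at B ℓ _)))))
  X-singular : detℚ X ≡ 0ℚ
  X-singular = detℚ-equal-columns X (λ e → g≢ℓ zero (sym e))
    λ i → trans (cong (λ v → v i) (setColumn-at B ℓ _)) (sym (setColumn-outside B _ (g zero) (g≢ℓ zero) i))
  Y-det : detℚ Y ≡ c * detℚ B
  Y-det = detℚ-add-combination ℓ c (λ k → w (suc k)) (λ k → g (suc k)) (λ k → g≢ℓ (suc k))
    (setColumn-outside B _) (λ i → cong (λ v → v i) (setColumn-at B ℓ _))

detℚ-replace-column : ∀ {d} {B Z : Matℚ d} ℓ (y : Fin d → ℚ) → AgreeOutside ℓ Z B →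
  (∀ i → Z ℓ i ≡ ∑[ j < d ] (y j * B j i)) → detℚ Z ≡ y ℓ * detℚ B
detℚ-replace-column {suc d} {B} ℓ y Z≈B Zℓ≡ =
  detℚ-add-combination ℓ (y ℓ) (λ k → y (punchIn ℓ k)) (punchIn ℓ) (punchInᵢ≢i ℓ) Z≈B
    λ i → trans (Zℓ≡ i) (sum-remove (λ j → y j * B j i))

detℚ-top-column : ∀ {d} (M : Matℚ (suc d)) ℓ → (∀ i → M ℓ (suc i) ≡ 0ℚ) →
                  detℚ M ≡ sgnℚ (toℕ ℓ) * M ℓ zero * detℚ (minor M ℓ)
detℚ-top-column M ℓ below≡0 = sum-single (λ j → sgnℚ (toℕ j) * M j zero * detℚ (minor M j)) ℓ λ k →
  trans (cong (sgnℚ (toℕ (punchIn ℓ k)) * M (punchIn ℓ k) zero ℚ.*_)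
          (detℚ-zero-column (minor M (punchIn ℓ k)) _ λ i' →
             trans (minor-punchOut M (punchInᵢ≢i ℓ k) i') (below≡0 i')))
        (ℚ.*-zeroʳ (sgnℚ (toℕ (punchIn ℓ k)) * M (punchIn ℓ k) zero))

independent⇒top≢0 : ∀ {D} (N : Matℚ (suc D)) x ℓ → LinearlyIndependent N → x ℓ ≢ 0ℚ →
                    (∀ i → (N · x) (suc i) ≡ 0ℚ) → (N · x) zero ≢ 0ℚ
independent⇒top≢0 N x ℓ N-indep xℓ≢0 lower≡0 top≡0 = xℓ≢0 (N-indep x (λ { zero → top≡0 ; (suc i) → lower≡0 i }) ℓ)

-- With a and b the top entries of N · x and N · ẑ, a kernel vector z of the minor yields the kernel
-- vector a ẑ − b x of N, where ẑ is z with 0 inserted at ℓ.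
minor-independent : ∀ {D} (N : Matℚ (suc D)) x ℓ → LinearlyIndependent N → x ℓ ≢ 0ℚ →
                    (∀ i → (N · x) (suc i) ≡ 0ℚ) → LinearlyIndependent (minor N ℓ)
minor-independent {D} N x ℓ N-indep xℓ≢0 lower≡0 z Nz≡0 k = p*q≡0⇒q≡0 a≢0 (begin
  a * z k                                 ≡⟨ drop-0 a (z k) (x (punchIn ℓ k)) ⟨
  a * z k + 0ℚ * x (punchIn ℓ k)          ≡⟨ cong (λ c → a * z k + c * x (punchIn ℓ k)) c≡0 ⟨
  a * z k + c * x (punchIn ℓ k)           ≡⟨ cong (λ u → a * u + c * x (punchIn ℓ k)) (insertAt-punchIn z ℓ 0ℚ k) ⟨
  v (punchIn ℓ k)                         ≡⟨ v≡0 (punchIn ℓ k) ⟩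
  0ℚ                                      ∎)
  where
  open ≡-Reasoning
  a = (N · x) zero
  a≢0 : a ≢ 0ℚ
  a≢0 = independent⇒top≢0 N x ℓ N-indep xℓ≢0 lower≡0
  b = (removeAt N ℓ · z) zero
  c = - b
  ẑ = insertAt z ℓ 0ℚ
  v : Fin (suc D) → ℚ
  v j = a * ẑ j + c * x j
  top : ∀ a b c n → a * (0ℚ * n + b) + c * a ≡ (b + c) * a
  top = solve-∀ ℚ-ring
  rest : ∀ a c n → a * (0ℚ * n + 0ℚ) + c * 0ℚ ≡ 0ℚ
  rest = solve-∀ ℚ-ring
  drop-0 : ∀ a z y → a * z + 0ℚ * y ≡ a * z
  drop-0 = solve-∀ ℚ-ring
  Nv≡0 : ∀ i → (N · v) i ≡ 0ℚ
  Nv≡0 i = trans (·-linear N a c ẑ x i) (trans (cong (λ u → a * u + c * (N · x) i) (·-insertAt N z ℓ 0ℚ i)) (rows i))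
    where
    rows : ∀ i → a * (0ℚ * N ℓ i + (removeAt N ℓ · z) i) + c * (N · x) i ≡ 0ℚ
    rows zero    = trans (top a b c (N ℓ zero)) (trans (cong (ℚ._* a) (ℚ.+-inverseʳ b)) (ℚ.*-zeroˡ a))
    rows (suc i) = trans (cong₂ (λ u w → a * (0ℚ * N ℓ (suc i) + u) + c * w) (Nz≡0 i) (lower≡0 i)) (rest a c (N ℓ (suc i)))
  v≡0 : ∀ j → v j ≡ 0ℚ
  v≡0 = N-indep v Nv≡0
  c≡0 : c ≡ 0ℚ
  c≡0 = p*q≡0⇒q≡0 xℓ≢0 (begin
    x ℓ * c                   ≡⟨ ℚ.*-comm (x ℓ) c ⟩
    c * x ℓ                   ≡⟨ ℚ.+-identityˡ (c * x ℓ) ⟨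
    0ℚ + c * x ℓ              ≡⟨ cong (ℚ._+ c * x ℓ) (ℚ.*-zeroʳ a) ⟨
    a * 0ℚ + c * x ℓ          ≡⟨ cong (λ u → a * u + c * x ℓ) (insertAt-lookup z ℓ 0ℚ) ⟨
    v ℓ                       ≡⟨ v≡0 ℓ ⟩
    0ℚ                        ∎)

-- Pick x ≠ 0 with N · x = a e₀; then a ≠ 0. Replacing a column ℓ with x ℓ ≠ 0 by N · x scales det
-- by x ℓ, while expanding along that column gives ± a times the minor at ℓ, nonzero by induction.
independent⇒detℚ≢0 : ∀ {d} (N : Matℚ d) → LinearlyIndependent N → detℚ N ≢ 0ℚ
independent⇒detℚ≢0 {ℕ.zero} N _ = ℚ.1≢0
independent⇒detℚ≢0 {suc D} N N-indep with homogeneous-nontrivial (ℕ.n<1+n D) (λ j i → N j (suc i))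
... | x , (ℓ , xℓ≢0) , lower≡0 = λ detN≡0 → *-≢0 (*-≢0 (sgnℚ-≢0 (toℕ ℓ)) a≢0) minor≢0 (begin
  sgnℚ (toℕ ℓ) * a * detℚ (minor N' ℓ)   ≡⟨ cong (λ t → sgnℚ (toℕ ℓ) * t * detℚ (minor N' ℓ)) (N'ℓ zero) ⟨
  sgnℚ (toℕ ℓ) * N' ℓ zero * detℚ (minor N' ℓ)
                                         ≡⟨ detℚ-top-column N' ℓ N'ℓ-below ⟨
  detℚ N'                                ≡⟨ detℚ-replace-column ℓ x (setColumn-outside N (N · x)) N'ℓ ⟩
  x ℓ * detℚ N                           ≡⟨ cong (x ℓ ℚ.*_) detN≡0 ⟩
  x ℓ * 0ℚ                               ≡⟨ ℚ.*-zeroʳ (x ℓ) ⟩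
  0ℚ                                     ∎)
  where
  open ≡-Reasoning
  a = (N · x) zero
  a≢0 : a ≢ 0ℚ
  a≢0 = independent⇒top≢0 N x ℓ N-indep xℓ≢0 lower≡0
  N' = setColumn N ℓ (N · x)
  N'ℓ : ∀ i → N' ℓ i ≡ (N · x) i
  N'ℓ i = cong (λ v → v i) (setColumn-at N ℓ (N · x))
  N'ℓ-below : ∀ i → N' ℓ (suc i) ≡ 0ℚ
  N'ℓ-below i = trans (N'ℓ (suc i)) (lower≡0 i)
  minor≢0 : detℚ (minor N' ℓ) ≢ 0ℚ
  minor≢0 e = independent⇒detℚ≢0 (minor N ℓ) (minor-independent N x ℓ N-indep xℓ≢0 lower≡0)
    (trans (sym (detℚ-cong (minor-agree-at (setColumn-outside N (N · x))))) e)

LinIndep⇒det≢0 : ∀ {d} (M : Mat d) → LinIndep M → det M ≢ + 0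
LinIndep⇒det≢0 M indep det≡0 = independent⇒detℚ≢0 (toℚᴹ M) indepℚ (trans (sym (toℚ-det M)) (cong toℚ det≡0))
  where
  indepℚ : LinearlyIndependent (toℚᴹ M)
  indepℚ x Mx≡0 = indep x λ i → trans (∑ℚ≡sum (λ j → x j * toℚ (M j i))) (Mx≡0 i)

-- Exchange steps

replaceCol-at : ∀ {d} (B : Mat d) ℓ v → replaceCol B ℓ v ℓ ≡ v
replaceCol-at B ℓ v with ℓ ≟ ℓ
... | yes _  = refl
... | no ℓ≢ℓ = ⊥-elim (ℓ≢ℓ refl)

replaceCol-outside : ∀ {d} (B : Mat d) {ℓ} v j → j ≢ ℓ → replaceCol B ℓ v j ≡ B j
replaceCol-outside B {ℓ} v j j≢ℓ with j ≟ ℓ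
... | yes j≡ℓ = ⊥-elim (j≢ℓ j≡ℓ)
... | no _    = refl

coeff-at : ∀ {d} (x : Fin d → ℚ) ℓ → coeff x ℓ ℓ ≡ nearest (x ℓ)
coeff-at x ℓ with ℓ ≟ ℓ
... | yes _  = refl
... | no ℓ≢ℓ = ⊥-elim (ℓ≢ℓ refl)

exchange-det : ∀ {d} (B : Mat d) c x ℓ → Solves B x c →
  toℚ (det (replaceCol B ℓ (newCol B c x ℓ))) ≡ (x ℓ - toℚ (nearest (x ℓ))) * toℚ (det B)
exchange-det {d} B c x ℓ sol = begin
  toℚ (det B')                                 ≡⟨ toℚ-det B' ⟩
  detℚ (toℚᴹ B')                               ≡⟨ detℚ-replace-column ℓ y agree new-column ⟩
  (x ℓ - κ ℓ) * detℚ (toℚᴹ B)                  ≡⟨ cong₂ (λ k D → (x ℓ - toℚ k) * D) (coeff-at x ℓ) (sym (toℚ-det B)) ⟩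
  (x ℓ - toℚ (nearest (x ℓ))) * toℚ (det B)    ∎
  where
  open ≡-Reasoning
  B' = replaceCol B ℓ (newCol B c x ℓ)
  κ : Fin d → ℚ
  κ j = toℚ (coeff x ℓ j)
  y : Fin d → ℚ
  y j = x j - κ j
  agree : AgreeOutside ℓ (toℚᴹ B') (toℚᴹ B)
  agree j j≢ℓ i = cong (λ v → toℚ (v i)) (replaceCol-outside B _ j j≢ℓ)
  as-combination : ∀ a b → a - b ≡ 1ℚ * a + (- 1ℚ) * b
  as-combination = solve-∀ ℚ-ring
  new-column : ∀ i → toℚᴹ B' ℓ i ≡ (toℚᴹ B · y) i
  new-column i = begin
    toℚ (B' ℓ i)                                ≡⟨ cong (λ v → toℚ (v i)) (replaceCol-at B ℓ _) ⟩
    toℚ (c i ℤ.- Bcoeff)                        ≡⟨ toℚ-+ (c i) (ℤ.- Bcoeff) ⟩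
    toℚ (c i) + toℚ (ℤ.- Bcoeff)                ≡⟨ cong (toℚ (c i) ℚ.+_) (toℚ-neg Bcoeff) ⟩
    toℚ (c i) - toℚ Bcoeff                      ≡⟨ cong₂ _-_ Bx Bκ ⟩
    (toℚᴹ B · x) i - (toℚᴹ B · κ) i             ≡⟨ as-combination ((toℚᴹ B · x) i) ((toℚᴹ B · κ) i) ⟩
    1ℚ * (toℚᴹ B · x) i + (- 1ℚ) * (toℚᴹ B · κ) i
                                                ≡⟨ ·-linear (toℚᴹ B) 1ℚ (- 1ℚ) x κ i ⟨
    (toℚᴹ B · (λ j → 1ℚ * x j + (- 1ℚ) * κ j)) i
                                                ≡⟨ sum-cong-≗ (λ j → cong (ℚ._* toℚ (B j i)) (as-combination (x j) (κ j))) ⟨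
    (toℚᴹ B · y) i                              ∎
    where
    Bcoeff = ∑ℤ (λ j → B j i ℤ.* coeff x ℓ j)
    Bx : toℚ (c i) ≡ (toℚᴹ B · x) i
    Bx = trans (sym (sol i)) (∑ℚ≡sum (λ j → x j * toℚ (B j i)))
    Bκ : toℚ Bcoeff ≡ (toℚᴹ B · κ) i
    Bκ = trans (toℚ-∑ (λ j → B j i ℤ.* coeff x ℓ j))
               (sum-cong-≗ λ j → trans (toℚ-* (B j i) (coeff x ℓ j)) (ℚ.*-comm (toℚ (B j i)) (κ j)))

2*∣m∣≤∣n∣ : ∀ m n y → toℚ m ≡ y * toℚ n → ℚ.∣ y ∣ ℚ.≤ ½ → 2 ℕ.* ∣ m ∣ ℕ.≤ ∣ n ∣
2*∣m∣≤∣n∣ m n y m≡yn ∣y∣≤½ = ℤ.drop‿+≤+ (toℚ-cancel-≤ (begin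
  toℚ (+ (2 ℕ.* ∣ m ∣))                    ≡⟨ cong (λ k → toℚ (+ (∣ m ∣ ℕ.+ k))) (ℕ.+-identityʳ ∣ m ∣) ⟩
  toℚ (+ ∣ m ∣ ℤ.+ + ∣ m ∣)                ≡⟨ toℚ-+ (+ ∣ m ∣) (+ ∣ m ∣) ⟩
  toℚ (+ ∣ m ∣) + toℚ (+ ∣ m ∣)             ≡⟨ cong₂ _+_ ∣m∣≡ ∣m∣≡ ⟩
  ℚ.∣ y ∣ * ∣n∣ + ℚ.∣ y ∣ * ∣n∣            ≤⟨ ℚ.+-mono-≤ ∣y∣∣n∣≤ ∣y∣∣n∣≤ ⟩
  ½ * ∣n∣ + ½ * ∣n∣                        ≡⟨ halves ∣n∣ ⟩
  ∣n∣                                      ≡⟨ toℚ-∣∣ n ⟩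
  toℚ (+ ∣ n ∣)                            ∎))
  where
  open ℚ.≤-Reasoning
  ∣n∣ = ℚ.∣ toℚ n ∣
  ∣m∣≡ : toℚ (+ ∣ m ∣) ≡ ℚ.∣ y ∣ * ∣n∣
  ∣m∣≡ = trans (sym (toℚ-∣∣ m)) (trans (cong ℚ.∣_∣ m≡yn) (ℚ.∣p*q∣≡∣p∣*∣q∣ y (toℚ n)))
  ∣y∣∣n∣≤ : ℚ.∣ y ∣ * ∣n∣ ℚ.≤ ½ * ∣n∣
  ∣y∣∣n∣≤ = ℚ.*-monoʳ-≤-nonNeg ∣n∣ {{ℚ.∣-∣-nonNeg (toℚ n)}} ∣y∣≤½
  halves : ∀ a → ½ * a + ½ * a ≡ a
  halves = solve-∀ ℚ-ring

exchange-halves : ∀ {d} (B : Mat d) c x ℓ → Solves B x c → ¬ IsInt (x ℓ) → det B ≢ + 0 →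
  let B' = replaceCol B ℓ (newCol B c x ℓ) in det B' ≢ + 0 × 2 ℕ.* ∣ det B' ∣ ℕ.≤ ∣ det B ∣
exchange-halves B c x ℓ sol frac detB≢0 =
  (λ detB'≡0 → *-≢0 (p-⌈p⌋≢0 (x ℓ) frac) detBℚ≢0 (trans (sym det-formula) (cong toℚ detB'≡0))) ,
  2*∣m∣≤∣n∣ (det (replaceCol B ℓ (newCol B c x ℓ))) (det B) _ det-formula (∣p-⌈p⌋∣≤½ (x ℓ))
  where
  det-formula : toℚ (det (replaceCol B ℓ (newCol B c x ℓ))) ≡ (x ℓ - toℚ (nearest (x ℓ))) * toℚ (det B)
  det-formula = exchange-det B c x ℓ sol
  detBℚ≢0 : toℚ (det B) ≢ 0ℚ
  detBℚ≢0 e = detB≢0 (toℚ-injective e)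

Run⇒2^k≤∣det∣ : ∀ {d} {B : Mat d} {C k S} → Run (B , C) k S → det B ≢ + 0 → 2 ^ k ℕ.≤ ∣ det B ∣
Run⇒2^k≤∣det∣ (done _) detB≢0 = ℕ.n≢0⇒n>0 (λ ∣detB∣≡0 → detB≢0 (ℤ.∣i∣≡0⇒i≡0 ∣detB∣≡0))
Run⇒2^k≤∣det∣ (next (integral _ _ _ _ _ _ _ _) run) detB≢0 = Run⇒2^k≤∣det∣ run detB≢0
Run⇒2^k≤∣det∣ (next (exchange B _ _ c x ℓ _ sol frac) run) detB≢0 =
  ℕ.≤-trans (ℕ.*-monoʳ-≤ 2 (Run⇒2^k≤∣det∣ run (proj₁ halving))) (proj₂ halving)
  where halving = exchange-halves B c x ℓ sol frac detB≢0

mainTheorem2 : (d n : ℕ) (A : Fin n → Col d) (σ : Fin d → Fin n) →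
               Injective _≡_ _≡_ σ → LinIndep (chosen A σ) →
               (k : ℕ) (S : State d) → Run (chosen A σ , remaining A σ) k S →
               2 ^ k ≤ ∣ det (chosen A σ) ∣
mainTheorem2 d n A σ _ indep k S run = Run⇒2^k≤∣det∣ run (LinIndep⇒det≢0 (chosen A σ) indep)
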